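{- For each graph $G$, $\mathbb{L}_\ell(G)$ is $3$-colourable in the following cases: (1) $\ell\geqslant0$ is even, and either $\chi(G)\leqslant3$ or $\ell>2\log_{1.5}(\chi(G)-3)$; (2) $\ell\geqslant1$ is odd, and either $\chi'(G)\leqslant3$ or $\ell>2\log_{1.5}(\chi'(G)-3)+1$.
   Context: All graphs are finite, undirected and loopless; parallel edges are allowed. For $\ell\geqslant0$, an $\ell$-arc of $G$ is a sequence $(v_0,e_1,v_1,\ldots,e_\ell,v_\ell)$ with each $e_i$ an edge with ends $v_{i-1},v_i$ and $e_i\neq e_{i+1}$; an $\ell$-link is an $\ell$-arc identified with its reverse. The $\ell$-link graph $\mathbb{L}_\ell(G)$ has vertex set the $\ell$-links of $G$, and $\ell$-links $L,R$ are joined by as many edges as there are $(\ell+1)$-links $[v_0,e_1,\ldots,e_{\ell+1},v_{\ell+1}]$ with $\{[v_0,\ldots,v_\ell],[v_1,\ldots,v_{\ell+1}]\}=\{L,R\}$. $\chi$ denotes chromatic number and $\chi'$ edge-chromatic number. -}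

module Defs where

open import Data.Nat using (ℕ; zero; suc; _≤_; _<_; _∸_; _*_; _^_)
open import Data.Fin using (Fin; zero; suc; toℕ; inject₁; opposite)
open import Data.Product using (_×_; _,_; proj₁; proj₂; ∃)
open import Data.Sum using (_⊎_)
open import Relation.Binary.PropositionalEquality using (_≡_; _≢_)
open import Relation.Nullary using (¬_)

-- A finite loopless multigraph: vertices Fin nV, edges Fin nE, each edge
-- has two (distinct) ends; parallel edges are allowed.
record Graph : Set where
  field
    nV : ℕ
    nE : ℕ
    ends : Fin nE → Fin nV × Fin nV
    loopless : ∀ e → proj₁ (ends e) ≢ proj₂ (ends e)

open Graph public

V : Graph → Set
V G = Fin (nV G)

E : Graph → Set
E G = Fin (nE G)

Joins : (G : Graph) → E G → V G → V G → Set
Joins G e u v = ends G e ≡ (u , v) ⊎ ends G e ≡ (v , u)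

IsEnd : (G : Graph) → V G → E G → Set
IsEnd G v e = proj₁ (ends G e) ≡ v ⊎ proj₂ (ends G e) ≡ v

-- An ℓ-arc (v₀,e₁,v₁,…,e_ℓ,v_ℓ): vertex i is vx i, edge e_{i+1} is ed i.
record Arc (G : Graph) (ℓ : ℕ) : Set where
  field
    vx : Fin (suc ℓ) → V G
    ed : Fin ℓ → E G
    joins : ∀ (i : Fin ℓ) → Joins G (ed i) (vx (inject₁ i)) (vx (suc i))
    nonback : ∀ (i j : Fin ℓ) → toℕ j ≡ suc (toℕ i) → ed i ≢ ed j

open Arc public

-- Two ℓ-arcs represent the same ℓ-link: equal, or one is the reverse of the other.
SameLink : {G : Graph} {ℓ : ℕ} → Arc G ℓ → Arc G ℓ → Set
SameLink A B =
  ((∀ i → vx A i ≡ vx B i) × (∀ i → ed A i ≡ ed B i))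
  ⊎ ((∀ i → vx A i ≡ vx B (opposite i)) × (∀ i → ed A i ≡ ed B (opposite i)))

IsPrefix : {G : Graph} {ℓ : ℕ} → Arc G ℓ → Arc G (suc ℓ) → Set
IsPrefix A B = (∀ i → vx A i ≡ vx B (inject₁ i)) × (∀ i → ed A i ≡ ed B (inject₁ i))

IsSuffix : {G : Graph} {ℓ : ℕ} → Arc G ℓ → Arc G (suc ℓ) → Set
IsSuffix A B = (∀ i → vx A i ≡ vx B (suc i)) × (∀ i → ed A i ≡ ed B (suc i))

-- A proper k-colouring of the ℓ-link graph 𝕃_ℓ(G): a colouring of ℓ-links
-- (i.e. of ℓ-arcs, constant on each link) such that the two ℓ-links
-- joined by any (ℓ+1)-link get different colours.
record LinkColouring (G : Graph) (ℓ : ℕ) (k : ℕ) : Set where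
  field
    col : Arc G ℓ → Fin k
    wellDef : ∀ A B → SameLink A B → col A ≡ col B
    proper : ∀ (B : Arc G (suc ℓ)) (A A' : Arc G ℓ) →
             IsPrefix A B → IsSuffix A' B → col A ≢ col A'

LinkColourable : Graph → ℕ → ℕ → Set
LinkColourable G ℓ k = LinkColouring G ℓ k

Colourable : Graph → ℕ → Set
Colourable G k = ∃ λ (c : V G → Fin k) →
  ∀ e → c (proj₁ (ends G e)) ≢ c (proj₂ (ends G e))

EdgeColourable : Graph → ℕ → Set
EdgeColourable G k = ∃ λ (c : E G → Fin k) →
  ∀ e f → e ≢ f → (∃ λ v → IsEnd G v e × IsEnd G v f) → c e ≢ c f

IsChromaticNumber : Graph → ℕ → Set
IsChromaticNumber G k = Colourable G k × (∀ j → j < k → ¬ Colourable G j)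

IsChromaticIndex : Graph → ℕ → Set
IsChromaticIndex G k = EdgeColourable G k × (∀ j → j < k → ¬ EdgeColourable G j)

module Submission where

-- Trace each ℓ-arc by a sequence of 2m+1 colours: for ℓ = 2m its vertex colours
-- under a proper χ(G)-colouring, for ℓ = 2m+1 its edge colours under a proper
-- χ'(G)-edge-colouring.  Links adjacent in 𝕃_ℓ(G) are the two halves of an
-- (ℓ+1)-arc, so their traces are the windows [0,2m], [1,2m+1] of one sequence
-- without equal consecutive entries.  A link is coloured by m rounds of a local
-- recolouring (a "reducer"): each inner entry is replaced by a colour depending
-- on it and on the unordered pair of its neighbours.  Such rounds respect
-- reversal, drop two entries, and keep consecutive entries distinct.  Grouping
-- the colours above the base colours 0, 1, 2 into blocks of three and recolouring
-- every full block with two new colours turns 3 + x colours into 3 + x' with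
-- 3x' ≤ 2x.  The hypothesis ℓ > 2 log_{1.5}(χ - 3) says 2^m (χ - 3) < 3^m, so m
-- rounds leave 3 colours.

open import Defs
open import Data.Nat using (ℕ; zero; suc; _+_; _*_; _∸_; _^_; _≤_; _<_; z≤n; s≤s; _≟_; _<?_)
open import Data.Nat.Properties
open import Data.Nat.GeneralisedArithmetic using (iterate)
open import Data.Nat.Tactic.RingSolver using (solve-∀)
open import Data.Fin using (Fin; zero; suc; toℕ; inject₁; opposite; fromℕ<)
open import Data.Fin.Properties using (toℕ<n; toℕ-injective; toℕ-inject₁; opposite-prop; fromℕ<-cong; fromℕ<-injective)
open import Data.Bool using (Bool; true; false)
open import Data.Bool.Properties using (∨-comm)
open import Data.Product using (_×_; _,_; proj₁; proj₂; map₁; uncurry)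
open import Data.Sum using (_⊎_; inj₁; inj₂; [_,_]) renaming (map to ⊎-map)
open import Function using (_∘_)
open import Relation.Nullary using (¬_; Dec; does; yes; no; contradiction)
open import Relation.Nullary.Decidable using (_⊎-dec_; dec-true; dec-false)
open import Relation.Binary.PropositionalEquality using (_≡_; _≢_; refl; sym; trans; cong; cong₂; subst; subst₂; ≢-sym; module ≡-Reasoning)
open import Relation.Binary.Definitions using (tri<; tri≈; tri>)

-- Colours 0, 1, 2 are base colours; colour 3 + idx q t is slot t of block q.
idx : ℕ → Fin 3 → ℕ
idx zero    t = toℕ t
idx (suc q) t = 3 + idx q t

slot : ℕ → Fin 3 → ℕ
slot q t = 3 + idx q t

split : ℕ → ℕ × Fin 3
split zero                   = 0 , zero
split (suc zero)             = 0 , suc zero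
split (suc (suc zero))       = 0 , suc (suc zero)
split (suc (suc (suc n)))    = map₁ suc (split n)

split-idx : ∀ q t → split (idx q t) ≡ (q , t)
split-idx zero zero                = refl
split-idx zero (suc zero)          = refl
split-idx zero (suc (suc zero))    = refl
split-idx (suc q) t                = cong (map₁ suc) (split-idx q t)

idx-split : ∀ n → uncurry idx (split n) ≡ n
idx-split zero                = refl
idx-split (suc zero)          = refl
idx-split (suc (suc zero))    = refl
idx-split (suc (suc (suc n))) = cong (3 +_) (idx-split n)

slot-injective : ∀ {q t q' t'} → slot q t ≡ slot q' t' → q ≡ q' × t ≡ t'
slot-injective {q} {t} {q'} {t'} eq
  with trans (sym (split-idx q t)) (trans (cong (split ∘ (_∸ 3)) eq) (split-idx q' t'))
... | refl = refl , refl

idx-< : ∀ q t q' t' → idx q t < idx q' t' → q < q' ⊎ (q ≡ q' × toℕ t < toℕ t')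
idx-< zero    t zero     t' lt = inj₂ (refl , lt)
idx-< zero    t (suc q') t' lt = inj₁ (s≤s z≤n)
idx-< (suc q) t zero     t' lt = contradiction (≤-trans lt (≤-pred (toℕ<n t'))) λ { (s≤s (s≤s ())) }
idx-< (suc q) t (suc q') t' (s≤s (s≤s (s≤s lt))) with idx-< q t q' t' lt
... | inj₁ q<q'          = inj₁ (s≤s q<q')
... | inj₂ (refl , t<t') = inj₂ (refl , t<t')

data ColourView : ℕ → Set where
  base  : ∀ {c} → c < 3 → ColourView c
  block : ∀ q t → ColourView (slot q t)

colourView : ∀ c → ColourView c
colourView zero                = base (s≤s z≤n)
colourView (suc zero)          = base (s≤s (s≤s z≤n))
colourView (suc (suc zero))    = base (s≤s (s≤s (s≤s z≤n)))
colourView (suc (suc (suc n))) =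
  subst (ColourView ∘ (3 +_)) (idx-split n) (block (proj₁ (split n)) (proj₂ (split n)))

-- A reducer from k to k' colours recolours the middle entry y of a window
-- (a, y, b) of a sequence.
record Reducer (k k' : ℕ) : Set where
  field
    apply     : ℕ → ℕ → ℕ → ℕ
    symmetric : ∀ a y b → apply a y b ≡ apply b y a
    bounded   : ∀ a y b → y < k → apply a y b < k'
    proper    : ∀ a y b w → y < k → b < k → y ≢ b → apply a y b ≢ apply y b w

-- The two new colours replacing block q; for q < q' they lie below those of q'.
lo hi : ℕ → ℕ
lo q = 3 + (q + q)
hi q = suc (lo q)

hi<lo : ∀ {q q'} → q < q' → hi q < lo q'
hi<lo {q} {suc k} (s≤s q≤k) =
  s≤s (s≤s (s≤s (s≤s (subst (q + q <_) (sym (+-suc k k)) (s≤s (+-mono-≤ q≤k q≤k))))))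

blocks-disjoint : ∀ {q q' u v} → q ≢ q' → lo q ≤ u → u ≤ hi q → lo q' ≤ v → v ≤ hi q' → u ≢ v
blocks-disjoint {q} {q'} q≢q' lo≤u u≤hi lo≤v v≤hi refl with <-cmp q q'
... | tri< q<q' _ _ = <⇒≱ (hi<lo q<q') (≤-trans lo≤v u≤hi)
... | tri≈ _ q≡q' _ = q≢q' q≡q'
... | tri> _ _ q>q' = <⇒≱ (hi<lo q>q') (≤-trans lo≤u v≤hi)

avoid : ℕ → ℕ → ℕ
avoid zero          zero             = 1
avoid zero          (suc zero)       = 2
avoid zero          (suc (suc _))    = 1
avoid (suc zero)    zero             = 2
avoid (suc zero)    (suc _)          = 0
avoid (suc (suc _)) zero             = 1
avoid (suc (suc _)) (suc _)          = 0

avoid-sym : ∀ a b → avoid a b ≡ avoid b a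
avoid-sym zero          zero          = refl
avoid-sym zero          (suc zero)    = refl
avoid-sym zero          (suc (suc _)) = refl
avoid-sym (suc zero)    zero          = refl
avoid-sym (suc zero)    (suc zero)    = refl
avoid-sym (suc zero)    (suc (suc _)) = refl
avoid-sym (suc (suc _)) zero          = refl
avoid-sym (suc (suc _)) (suc zero)    = refl
avoid-sym (suc (suc _)) (suc (suc _)) = refl

avoid<3 : ∀ a b → avoid a b < 3
avoid<3 zero          zero          = s≤s (s≤s z≤n)
avoid<3 zero          (suc zero)    = s≤s (s≤s (s≤s z≤n))
avoid<3 zero          (suc (suc _)) = s≤s (s≤s z≤n)
avoid<3 (suc zero)    zero          = s≤s (s≤s (s≤s z≤n))
avoid<3 (suc zero)    (suc _)       = s≤s z≤n
avoid<3 (suc (suc _)) zero          = s≤s (s≤s z≤n)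
avoid<3 (suc (suc _)) (suc _)       = s≤s z≤n

avoid≢ˡ : ∀ a b → avoid a b ≢ a
avoid≢ˡ zero          zero          ()
avoid≢ˡ zero          (suc zero)    ()
avoid≢ˡ zero          (suc (suc _)) ()
avoid≢ˡ (suc zero)    zero          ()
avoid≢ˡ (suc zero)    (suc _)       ()
avoid≢ˡ (suc (suc _)) zero          ()
avoid≢ˡ (suc (suc _)) (suc _)       ()

avoid≢ʳ : ∀ a b → avoid a b ≢ b
avoid≢ʳ a b rewrite avoid-sym a b = avoid≢ˡ b a

touches? : ∀ a b c → Dec (a ≡ c ⊎ b ≡ c)
touches? a b c = (a ≟ c) ⊎-dec (b ≟ c)

touches-sym : ∀ a b c → does (touches? a b c) ≡ does (touches? b a c)
touches-sym a b c = ∨-comm (does (a ≟ c)) (does (b ≟ c))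

-- Recolouring of a full block q: slot 0 ↦ lo q, slot 1 ↦ hi q, and slot 2 takes
-- lo q, unless it touches slot 0 (then hi q) or slots 0 and 1 (then base 0).
thirdSlot : ℕ → Bool → Bool → ℕ
thirdSlot q true  true  = 0
thirdSlot q true  false = hi q
thirdSlot q false _     = lo q

fullBlock : ℕ → Fin 3 → ℕ → ℕ → ℕ
fullBlock q zero             a b = lo q
fullBlock q (suc zero)       a b = hi q
fullBlock q (suc (suc zero)) a b =
  thirdSlot q (does (touches? a b (slot q zero))) (does (touches? a b (slot q (suc zero))))

fullBlock-sym : ∀ q t a b → fullBlock q t a b ≡ fullBlock q t b a
fullBlock-sym q zero             a b = refl
fullBlock-sym q (suc zero)       a b = refl
fullBlock-sym q (suc (suc zero)) a b =
  cong₂ (thirdSlot q) (touches-sym a b (slot q zero)) (touches-sym a b (slot q (suc zero)))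

fullBlock≤hi : ∀ q t a b → fullBlock q t a b ≤ hi q
fullBlock≤hi q zero             a b = n≤1+n (lo q)
fullBlock≤hi q (suc zero)       a b = ≤-refl
fullBlock≤hi q (suc (suc zero)) a b
  with does (touches? a b (slot q zero)) | does (touches? a b (slot q (suc zero)))
... | true  | true  = z≤n
... | true  | false = ≤-refl
... | false | _     = n≤1+n (lo q)

slot0≢slot1 : ∀ q → slot q zero ≢ slot q (suc zero)
slot0≢slot1 q eq with slot-injective {q} {zero} {q} {suc zero} eq
... | _ , ()

-- Only slot 2 with both slots 0 and 1 as neighbours leaves the block's range;
-- so if the neighbour b is neither slot 0 nor slot 1, the colour is ≥ lo q.
fullBlock-high : ∀ q t a b → b ≢ slot q zero → b ≢ slot q (suc zero) → lo q ≤ fullBlock q t a b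
fullBlock-high q zero             a b _ _ = ≤-refl
fullBlock-high q (suc zero)       a b _ _ = n≤1+n (lo q)
fullBlock-high q (suc (suc zero)) a b b≢s₀ b≢s₁ with a ≟ slot q zero
... | no a≢s₀ rewrite dec-false (touches? a b (slot q zero)) ([ a≢s₀ , b≢s₀ ]) = ≤-refl
... | yes a≡s₀
  rewrite dec-false (touches? a b (slot q (suc zero)))
                    ([ (λ a≡s₁ → slot0≢slot1 q (trans (sym a≡s₀) a≡s₁)) , b≢s₁ ])
  with does (touches? a b (slot q zero))
...   | true  = n≤1+n (lo q)
...   | false = ≤-refl

-- Two slots of one full block that are neighbours get different colours: a
-- slot 2 next to slot 0 avoids lo q, and a slot 2 next to slot 1 avoids hi q.
slot2-next-to-slot0 : ∀ q a b → (a ≡ slot q zero ⊎ b ≡ slot q zero) →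
                      fullBlock q (suc (suc zero)) a b ≢ lo q
slot2-next-to-slot0 q a b touching rewrite dec-true (touches? a b (slot q zero)) touching
  with does (touches? a b (slot q (suc zero)))
... | true  = <⇒≢ (s≤s z≤n)
... | false = >⇒≢ (n<1+n (lo q))

slot2-next-to-slot1 : ∀ q a b → (a ≡ slot q (suc zero) ⊎ b ≡ slot q (suc zero)) →
                      fullBlock q (suc (suc zero)) a b ≢ hi q
slot2-next-to-slot1 q a b touching rewrite dec-true (touches? a b (slot q (suc zero))) touching
  with does (touches? a b (slot q zero))
... | true  = <⇒≢ (s≤s z≤n)
... | false = <⇒≢ (n<1+n (lo q))

fullBlock-sameBlock : ∀ q t t' a w → t ≢ t' →
                      fullBlock q t a (slot q t') ≢ fullBlock q t' (slot q t) w
fullBlock-sameBlock q zero             zero             a w t≢t' = contradiction refl t≢t'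
fullBlock-sameBlock q zero             (suc zero)       a w _ = <⇒≢ (n<1+n (lo q))
fullBlock-sameBlock q zero             (suc (suc zero)) a w _ =
  ≢-sym (slot2-next-to-slot0 q (slot q zero) w (inj₁ refl))
fullBlock-sameBlock q (suc zero)       zero             a w _ = >⇒≢ (n<1+n (lo q))
fullBlock-sameBlock q (suc zero)       (suc zero)       a w t≢t' = contradiction refl t≢t'
fullBlock-sameBlock q (suc zero)       (suc (suc zero)) a w _ =
  ≢-sym (slot2-next-to-slot1 q (slot q (suc zero)) w (inj₁ refl))
fullBlock-sameBlock q (suc (suc zero)) zero             a w _ =
  slot2-next-to-slot0 q a (slot q zero) (inj₂ refl)
fullBlock-sameBlock q (suc (suc zero)) (suc zero)       a w _ =
  slot2-next-to-slot1 q a (slot q (suc zero)) (inj₂ refl)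
fullBlock-sameBlock q (suc (suc zero)) (suc (suc zero)) a w t≢t' = contradiction refl t≢t'

-- Number of new colours needed by the incomplete last block with r slots.
extra : Fin 3 → ℕ
extra (suc (suc zero)) = 1
extra _                = 0

lastBlock : ℕ → Fin 3 → Fin 3 → ℕ → ℕ → ℕ
lastBlock g (suc (suc zero)) zero a b = lo g
lastBlock g _                _    a b = avoid a b

lastBlock-cases : ∀ g r t a b → lastBlock g r t a b ≡ lo g ⊎ lastBlock g r t a b ≡ avoid a b
lastBlock-cases g zero             t       a b = inj₂ refl
lastBlock-cases g (suc zero)       t       a b = inj₂ refl
lastBlock-cases g (suc (suc zero)) zero    a b = inj₁ refl
lastBlock-cases g (suc (suc zero)) (suc t) a b = inj₂ refl

lastBlock-sym : ∀ g r t a b → lastBlock g r t a b ≡ lastBlock g r t b a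
lastBlock-sym g zero             t       a b = avoid-sym a b
lastBlock-sym g (suc zero)       t       a b = avoid-sym a b
lastBlock-sym g (suc (suc zero)) zero    a b = refl
lastBlock-sym g (suc (suc zero)) (suc t) a b = avoid-sym a b

lastBlock-bounded : ∀ g r t a b → toℕ t < toℕ r → lastBlock g r t a b < 3 + (g + g + extra r)
lastBlock-bounded g (suc zero)       zero          a b _ = ≤-trans (avoid<3 a b) (m≤m+n 3 _)
lastBlock-bounded g (suc zero)       (suc t)       a b (s≤s ())
lastBlock-bounded g (suc (suc zero)) zero          a b _ =
  +-monoʳ-< 3 (m<m+n (g + g) (s≤s z≤n))
lastBlock-bounded g (suc (suc zero)) (suc zero)    a b _ = ≤-trans (avoid<3 a b) (m≤m+n 3 _)
lastBlock-bounded g (suc (suc zero)) (suc (suc zero)) a b (s≤s (s≤s ()))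

-- Neighbouring slots of the last block are slots 0 and 1 of a 2-slot block.
lastBlock-distinct : ∀ g r t t' a b c d → toℕ t < toℕ r → toℕ t' < toℕ r → t ≢ t' →
                     lastBlock g r t a b ≢ lastBlock g r t' c d
lastBlock-distinct g (suc zero)       zero          zero          a b c d _ _ t≢t' =
  contradiction refl t≢t'
lastBlock-distinct g (suc zero)       (suc t)       t'            a b c d (s≤s ()) _ _
lastBlock-distinct g (suc zero)       t             (suc t')      a b c d _ (s≤s ()) _
lastBlock-distinct g (suc (suc zero)) zero          zero          a b c d _ _ t≢t' =
  contradiction refl t≢t'
lastBlock-distinct g (suc (suc zero)) zero          (suc zero)    a b c d _ _ _ =
  >⇒≢ (≤-trans (avoid<3 c d) (m≤m+n 3 _))
lastBlock-distinct g (suc (suc zero)) (suc zero)    zero          a b c d _ _ _ =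
  <⇒≢ (≤-trans (avoid<3 a b) (m≤m+n 3 _))
lastBlock-distinct g (suc (suc zero)) (suc zero)    (suc zero)    a b c d _ _ t≢t' =
  contradiction refl t≢t'
lastBlock-distinct g (suc (suc zero)) (suc (suc zero)) t'         a b c d (s≤s (s≤s ())) _ _
lastBlock-distinct g (suc (suc zero)) t (suc (suc zero))          a b c d _ (s≤s (s≤s ())) _

base<lo : ∀ {c} q → c < 3 → c < lo q
base<lo q c<3 = ≤-trans c<3 (m≤m+n 3 (q + q))

base≢slot : ∀ {c} q t → c < 3 → c ≢ slot q t
base≢slot q t c<3 = <⇒≢ (≤-trans c<3 (m≤m+n 3 (idx q t)))

fullBlock-avoids-base : ∀ {c} q t a b → c < 3 → (a ≡ c ⊎ b ≡ c) → fullBlock q t a b ≢ c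
fullBlock-avoids-base q t a b c<3 (inj₂ refl) =
  >⇒≢ (<-≤-trans (base<lo q c<3) (fullBlock-high q t a b (base≢slot q zero c<3) (base≢slot q (suc zero) c<3)))
fullBlock-avoids-base q t a b c<3 (inj₁ refl) rewrite fullBlock-sym q t a b =
  fullBlock-avoids-base q t b a c<3 (inj₂ refl)

slot-otherBlock : ∀ {q q'} t t' → q ≢ q' → slot q t ≢ slot q' t'
slot-otherBlock t t' q≢q' = q≢q' ∘ proj₁ ∘ slot-injective

fullBlock-nextToOther : ∀ q t a q' t' → q ≢ q' → lo q ≤ fullBlock q t a (slot q' t')
fullBlock-nextToOther q t a q' t' q≢q' =
  fullBlock-high q t a (slot q' t') (slot-otherBlock t' zero (≢-sym q≢q')) (slot-otherBlock t' (suc zero) (≢-sym q≢q'))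

fullBlock-nextToOtherˡ : ∀ q t q' t' b → q ≢ q' → lo q ≤ fullBlock q t (slot q' t') b
fullBlock-nextToOtherˡ q t q' t' b q≢q' =
  subst (lo q ≤_) (fullBlock-sym q t b (slot q' t')) (fullBlock-nextToOther q t b q' t' q≢q')

-- The block reducer for the palette of 3 + idx g r colours: blocks q < g are
-- full, block g has r slots.  It recolours into 3 + (g + g + extra r) colours.
module BlockReducer (g : ℕ) (r : Fin 3) where

  blockColour : ℕ → ℕ → Fin 3 → ℕ → ℕ
  blockColour a q t b with q <? g
  ... | yes _ = fullBlock q t a b
  ... | no _  = lastBlock g r t a b

  recolour : ℕ → ℕ → ℕ → ℕ
  recolour a zero                b = 0
  recolour a (suc zero)          b = 1
  recolour a (suc (suc zero))    b = 2
  recolour a (suc (suc (suc n))) b = blockColour a (proj₁ (split n)) (proj₂ (split n)) b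

  recolour-base : ∀ a c b → c < 3 → recolour a c b ≡ c
  recolour-base a zero             b _ = refl
  recolour-base a (suc zero)       b _ = refl
  recolour-base a (suc (suc zero)) b _ = refl
  recolour-base a (suc (suc (suc c))) b (s≤s (s≤s (s≤s ())))

  recolour-slot : ∀ a q t b → recolour a (slot q t) b ≡ blockColour a q t b
  recolour-slot a q t b = cong (λ p → blockColour a (proj₁ p) (proj₂ p) b) (split-idx q t)

  blockColour-full : ∀ a q t b → q < g → blockColour a q t b ≡ fullBlock q t a b
  blockColour-full a q t b q<g with q <? g
  ... | yes _   = refl
  ... | no q≮g = contradiction q<g q≮g

  blockColour-last : ∀ a q t b → ¬ q < g → blockColour a q t b ≡ lastBlock g r t a b
  blockColour-last a q t b q≮g with q <? g
  ... | yes q<g = contradiction q<g q≮g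
  ... | no _    = refl

  blockColour-sym : ∀ a q t b → blockColour a q t b ≡ blockColour b q t a
  blockColour-sym a q t b with q <? g
  ... | yes _ = fullBlock-sym q t a b
  ... | no _  = lastBlock-sym g r t a b

  data InPalette (q : ℕ) (t : Fin 3) : Set where
    full : q < g → InPalette q t
    last : q ≡ g → toℕ t < toℕ r → InPalette q t

  inPalette : ∀ q t → slot q t < 3 + idx g r → InPalette q t
  inPalette q t (s≤s (s≤s (s≤s lt))) with idx-< q t g r lt
  ... | inj₁ q<g         = full q<g
  ... | inj₂ (q≡g , t<r) = last q≡g t<r

  blockColour-avoids-base : ∀ {c} a q t b → c < 3 → (a ≡ c ⊎ b ≡ c) → blockColour a q t b ≢ c
  blockColour-avoids-base a q t b c<3 touching with q <? g | lastBlock-cases g r t a b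
  ... | yes _ | _         = fullBlock-avoids-base q t a b c<3 touching
  ... | no _  | inj₁ isLo = λ eq → <⇒≢ (base<lo g c<3) (sym (trans (sym isLo) eq))
  ... | no _  | inj₂ isAvoid with touching
  ...   | inj₁ refl = avoid≢ˡ a b ∘ trans (sym isAvoid)
  ...   | inj₂ refl = avoid≢ʳ a b ∘ trans (sym isAvoid)

  full≢last : ∀ {q u} → q < g → lo q ≤ u → u ≤ hi q → ∀ t a b → u ≢ lastBlock g r t a b
  full≢last {q} q<g lo≤u u≤hi t a b with lastBlock-cases g r t a b
  ... | inj₁ isLo     = λ eq → <⇒≢ (≤-<-trans u≤hi (hi<lo q<g)) (trans eq isLo)
  ... | inj₂ isAvoid  = λ eq → >⇒≢ (<-≤-trans (base<lo q (avoid<3 a b)) lo≤u) (trans eq isAvoid)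

  blockColour-proper : ∀ a q t q' t' w → InPalette q t → InPalette q' t' → slot q t ≢ slot q' t' →
                       blockColour a q t (slot q' t') ≢ blockColour (slot q t) q' t' w
  blockColour-proper a q t q' t' w (full q<g) (full q'<g) y≢b
    rewrite blockColour-full a q t (slot q' t') q<g | blockColour-full (slot q t) q' t' w q'<g
    with q ≟ q'
  ... | yes refl = fullBlock-sameBlock q t t' a w (y≢b ∘ cong (slot q))
  ... | no q≢q'  = blocks-disjoint q≢q'
      (fullBlock-nextToOther q t a q' t' q≢q') (fullBlock≤hi q t a (slot q' t'))
      (fullBlock-nextToOtherˡ q' t' q t w (≢-sym q≢q')) (fullBlock≤hi q' t' (slot q t) w)
  blockColour-proper a q t q' t' w (full q<g) (last refl _) _
    rewrite blockColour-full a q t (slot g t') q<g | blockColour-last (slot q t) g t' w (<-irrefl refl) =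
    full≢last q<g (fullBlock-nextToOther q t a g t' (<⇒≢ q<g)) (fullBlock≤hi q t a (slot g t')) t' (slot q t) w
  blockColour-proper a q t q' t' w (last refl _) (full q'<g) _
    rewrite blockColour-last a g t (slot q' t') (<-irrefl refl) | blockColour-full (slot g t) q' t' w q'<g =
    ≢-sym (full≢last q'<g (fullBlock-nextToOtherˡ q' t' g t w (<⇒≢ q'<g)) (fullBlock≤hi q' t' (slot g t) w)
                     t a (slot q' t'))
  blockColour-proper a q t q' t' w (last refl t<r) (last refl t'<r) y≢b
    rewrite blockColour-last a g t (slot g t') (<-irrefl refl) | blockColour-last (slot g t) g t' w (<-irrefl refl) =
    lastBlock-distinct g r t t' a (slot g t') (slot g t) w t<r t'<r (y≢b ∘ cong (slot g))

  recolour-sym : ∀ a y b → recolour a y b ≡ recolour b y a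
  recolour-sym a zero                b = refl
  recolour-sym a (suc zero)          b = refl
  recolour-sym a (suc (suc zero))    b = refl
  recolour-sym a (suc (suc (suc n))) b = blockColour-sym a (proj₁ (split n)) (proj₂ (split n)) b

  recolour-bounded : ∀ a y b → y < 3 + idx g r → recolour a y b < 3 + (g + g + extra r)
  recolour-bounded a y b y< with colourView y
  ... | base c<3 rewrite recolour-base a y b c<3 = ≤-trans c<3 (m≤m+n 3 _)
  ... | block q t rewrite recolour-slot a q t b with inPalette q t y<
  ...   | full q<g rewrite blockColour-full a q t b q<g =
    <-≤-trans (≤-<-trans (fullBlock≤hi q t a b) (hi<lo q<g)) (+-monoʳ-≤ 3 (m≤m+n (g + g) _))
  ...   | last refl t<r rewrite blockColour-last a g t b (<-irrefl refl) = lastBlock-bounded g r t a b t<r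

  recolour-proper : ∀ a y b w → y < 3 + idx g r → b < 3 + idx g r → y ≢ b →
                    recolour a y b ≢ recolour y b w
  recolour-proper a y b w y< b< y≢b with colourView y | colourView b
  ... | base y<3 | base b<3
    rewrite recolour-base a y b y<3 | recolour-base y b w b<3 = y≢b
  ... | base y<3 | block q' t'
    rewrite recolour-base a y (slot q' t') y<3 | recolour-slot y q' t' w =
    ≢-sym (blockColour-avoids-base y q' t' w y<3 (inj₁ refl))
  ... | block q t | base b<3
    rewrite recolour-slot a q t b | recolour-base (slot q t) b w b<3 =
    blockColour-avoids-base a q t b b<3 (inj₂ refl)
  ... | block q t | block q' t'
    rewrite recolour-slot a q t (slot q' t') | recolour-slot (slot q t) q' t' w =
    blockColour-proper a q t q' t' w (inPalette q t y<) (inPalette q' t' b<) y≢b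

  reducer : Reducer (3 + idx g r) (3 + (g + g + extra r))
  reducer = record
    { apply     = recolour
    ; symmetric = recolour-sym
    ; bounded   = recolour-bounded
    ; proper    = recolour-proper
    }

shrink : ℕ → ℕ
shrink x = proj₁ (split x) + proj₁ (split x) + extra (proj₂ (split x))

blockReducer : ∀ x → Reducer (3 + x) (3 + shrink x)
blockReducer x = subst (λ k → Reducer k (3 + shrink x)) (cong (3 +_) (idx-split x))
                       (BlockReducer.reducer (proj₁ (split x)) (proj₂ (split x)))

shrink-idx : ∀ g r → 3 * (g + g + extra r) ≤ 2 * idx g r
shrink-idx zero    zero             = z≤n
shrink-idx zero    (suc zero)       = z≤n
shrink-idx zero    (suc (suc zero)) = s≤s (s≤s (s≤s z≤n))
shrink-idx (suc g) r =
  subst₂ _≤_ (unfold₃ g (extra r)) (unfold₂ (idx g r)) (+-monoʳ-≤ 6 (shrink-idx g r))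
  where
  unfold₃ : ∀ g e → 6 + 3 * (g + g + e) ≡ 3 * (suc g + suc g + e)
  unfold₃ = solve-∀
  unfold₂ : ∀ i → 6 + 2 * i ≡ 2 * (3 + i)
  unfold₂ = solve-∀

shrink-contracts : ∀ x → 3 * shrink x ≤ 2 * x
shrink-contracts x =
  subst (λ k → 3 * shrink x ≤ 2 * k) (idx-split x) (shrink-idx (proj₁ (split x)) (proj₂ (split x)))

iterate-vanishes : ∀ m x → 2 ^ m * x < 3 ^ m → iterate shrink x m ≡ 0
iterate-vanishes zero    x lt = n<1⇒n≡0 (subst (_< 1) (*-identityˡ x) lt)
iterate-vanishes (suc m) x lt = iterate-vanishes m (shrink x) (*-cancelˡ-< 3 _ _ (begin-strict
  3 * (2 ^ m * shrink x)  ≡⟨ regroup (2 ^ m) (shrink x) ⟩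
  2 ^ m * (3 * shrink x)  ≤⟨ *-monoʳ-≤ (2 ^ m) (shrink-contracts x) ⟩
  2 ^ m * (2 * x)         ≡⟨ reassoc (2 ^ m) x ⟩
  2 ^ suc m * x           <⟨ lt ⟩
  3 * 3 ^ m               ∎))
  where
  open ≤-Reasoning
  regroup : ∀ p s → 3 * (p * s) ≡ p * (3 * s)
  regroup = solve-∀
  reassoc : ∀ p x → p * (2 * x) ≡ 2 * p * x
  reassoc = solve-∀

iterate-zero : ∀ m → iterate shrink 0 m ≡ 0
iterate-zero zero    = refl
iterate-zero (suc m) = iterate-zero m

halve-exponent : ∀ m x → 2 ^ (2 * m) * x ^ 2 < 3 ^ (2 * m) → 2 ^ m * x < 3 ^ m
halve-exponent m x lt with 2 ^ m * x <? 3 ^ m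
... | yes done = done
... | no ≮ = contradiction (^-monoˡ-≤ 2 (≮⇒≥ ≮))
                          (<⇒≱ (subst₂ _<_ (square-product (2 ^ m) x) (square 3) lt'))
  where
  square : ∀ a → a ^ (2 * m) ≡ (a ^ m) ^ 2
  square a = trans (cong (a ^_) (*-comm 2 m)) (sym (^-*-assoc a m 2))
  -- (a b)² = a² b², where z ^ 2 unfolds to z * (z * 1)
  square-product : ∀ a b → a * (a * 1) * (b * (b * 1)) ≡ a * b * (a * b * 1)
  square-product = solve-∀
  lt' : (2 ^ m) ^ 2 * x ^ 2 < 3 ^ (2 * m)
  lt' = subst (λ p → p * x ^ 2 < 3 ^ (2 * m)) (square 2) lt

-- The numerical hypothesis of the theorem (with 2m = ℓ, resp. ℓ - 1) makes m
-- rounds exhaust the excess χ - 3.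
excess-vanishes : ∀ m χ → χ ≤ 3 ⊎ 2 ^ (2 * m) * (χ ∸ 3) ^ 2 < 3 ^ (2 * m) →
                  iterate shrink (χ ∸ 3) m ≡ 0
excess-vanishes m χ (inj₁ χ≤3) rewrite m≤n⇒m∸n≡0 χ≤3 = iterate-zero m
excess-vanishes m χ (inj₂ lt)  = iterate-vanishes m (χ ∸ 3) (halve-exponent m (χ ∸ 3) lt)

-- Sequences are functions ℕ → ℕ, of which only an initial segment matters.
-- s takes values below k at positions 0, …, n:
Bounded : ℕ → ℕ → (ℕ → ℕ) → Set
Bounded k n s = ∀ i → i ≤ n → s i < k

Alternating : ℕ → (ℕ → ℕ) → Set
Alternating n s = ∀ i → i < n → s i ≢ s (suc i)

Agree : ℕ → (ℕ → ℕ) → (ℕ → ℕ) → Set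
Agree n s s' = ∀ i → i ≤ n → s i ≡ s' i

double : ℕ → ℕ
double zero    = zero
double (suc m) = suc (suc (double m))

double≡2* : ∀ m → double m ≡ 2 * m
double≡2* zero    = refl
double≡2* (suc m) = trans (cong (2 +_) (double≡2* m)) (two-more m)
  where
  two-more : ∀ m → 2 + 2 * m ≡ 2 * suc m
  two-more = solve-∀

module Iteration (shrink : ℕ → ℕ) (ρ : ∀ x → Reducer (3 + x) (3 + shrink x)) where
  open Reducer

  step : ℕ → (ℕ → ℕ) → ℕ → ℕ
  step x s i = apply (ρ x) (s i) (s (suc i)) (s (suc (suc i)))

  reduce : ℕ → ℕ → (ℕ → ℕ) → ℕ
  reduce x zero    s = s 0
  reduce x (suc m) s = reduce (shrink x) m (step x s)

  step-cong : ∀ x n s s' → Agree (2 + n) s s' → Agree n (step x s) (step x s')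
  step-cong x n s s' agree i i≤n
    rewrite agree i (≤-trans i≤n (m≤n+m n 2))
          | agree (1 + i) (s≤s (≤-trans i≤n (n≤1+n n)))
          | agree (2 + i) (s≤s (s≤s i≤n)) = refl

  reduce-cong : ∀ x m s s' → Agree (double m) s s' → reduce x m s ≡ reduce x m s'
  reduce-cong x zero    s s' agree = agree 0 z≤n
  reduce-cong x (suc m) s s' agree =
    reduce-cong (shrink x) m (step x s) (step x s') (step-cong x (double m) s s' agree)

  -- Reversing the sequence reverses every round, since reducers are symmetric.
  step-reverse : ∀ x n s → Agree n (step x (λ i → s (2 + n ∸ i))) (λ i → step x s (n ∸ i))
  step-reverse x n s i i≤n rewrite +-∸-assoc 2 i≤n | +-∸-assoc 1 i≤n =
    symmetric (ρ x) (s (2 + (n ∸ i))) (s (1 + (n ∸ i))) (s (n ∸ i))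

  reduce-reverse : ∀ x m s → reduce x m (λ i → s (double m ∸ i)) ≡ reduce x m s
  reduce-reverse x zero    s = refl
  reduce-reverse x (suc m) s = begin
    reduce (shrink x) m (step x (λ i → s (double (suc m) ∸ i)))
      ≡⟨ reduce-cong (shrink x) m _ _ (step-reverse x (double m) s) ⟩
    reduce (shrink x) m (λ i → step x s (double m ∸ i))
      ≡⟨ reduce-reverse (shrink x) m (step x s) ⟩
    reduce (shrink x) m (step x s) ∎
    where open ≡-Reasoning

  step-bounded : ∀ x n s → Bounded (3 + x) (2 + n) s → Bounded (3 + shrink x) n (step x s)
  step-bounded x n s bnd i i≤n =
    bounded (ρ x) (s i) (s (1 + i)) (s (2 + i)) (bnd (1 + i) (s≤s (m≤n⇒m≤1+n i≤n)))

  step-alternating : ∀ x n s → Bounded (3 + x) (2 + n) s → Alternating (2 + n) s →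
                     Alternating n (step x s)
  step-alternating x n s bnd alt i i<n =
    proper (ρ x) (s i) (s (1 + i)) (s (2 + i)) (s (3 + i))
           (bnd (1 + i) (≤-trans i<n (m≤n+m n 2))) (bnd (2 + i) (s≤s (s≤s (<⇒≤ i<n))))
           (alt (1 + i) (s≤s (m≤n⇒m≤1+n i<n)))

  reduce-bounded : ∀ x m s → Bounded (3 + x) (double m) s → reduce x m s < 3 + iterate shrink x m
  reduce-bounded x zero    s bnd = bnd 0 z≤n
  reduce-bounded x (suc m) s bnd = reduce-bounded (shrink x) m (step x s) (step-bounded x (double m) s bnd)

  reduce-proper : ∀ x m s → Bounded (3 + x) (suc (double m)) s → Alternating (suc (double m)) s →
                  reduce x m s ≢ reduce x m (s ∘ suc)
  reduce-proper x zero    s bnd alt = alt 0 (s≤s z≤n)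
  reduce-proper x (suc m) s bnd alt =
    reduce-proper (shrink x) m (step x s) (step-bounded x (suc (double m)) s bnd)
                  (step-alternating x (suc (double m)) s bnd alt)

open Iteration shrink blockReducer

-- Reading a Fin-indexed sequence of length n + 1 as a sequence ℕ → ℕ.
clamp : (n : ℕ) → ℕ → Fin (suc n)
clamp n       zero    = zero
clamp zero    (suc i) = zero
clamp (suc n) (suc i) = suc (clamp n i)

toℕ-clamp : ∀ {n i} → i ≤ n → toℕ (clamp n i) ≡ i
toℕ-clamp {n}     {zero}  _           = refl
toℕ-clamp {suc n} {suc i} (s≤s i≤n) = cong suc (toℕ-clamp i≤n)

clamp-inject₁ : ∀ {n i} → i ≤ n → clamp (suc n) i ≡ inject₁ (clamp n i)
clamp-inject₁ {n}     {zero}  _           = refl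
clamp-inject₁ {suc n} {suc i} (s≤s i≤n) = cong suc (clamp-inject₁ i≤n)

clamp-opposite : ∀ {n i} → i ≤ n → opposite (clamp n i) ≡ clamp n (n ∸ i)
clamp-opposite {n} {i} i≤n = toℕ-injective (begin
  toℕ (opposite (clamp n i))  ≡⟨ opposite-prop (clamp n i) ⟩
  n ∸ toℕ (clamp n i)         ≡⟨ cong (n ∸_) (toℕ-clamp i≤n) ⟩
  n ∸ i                       ≡⟨ sym (toℕ-clamp (m∸n≤m n i)) ⟩
  toℕ (clamp n (n ∸ i))       ∎)
  where open ≡-Reasoning

-- A trace records for every ℓ-arc a sequence of n + 1 colours in Fin χ (its
-- vertex or edge colours).
record Trace (G : Graph) (ℓ n χ : ℕ) : Set where
  field
    trace       : Arc G ℓ → Fin (suc n) → Fin χ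
    trace⁺      : Arc G (suc ℓ) → Fin (suc (suc n)) → Fin χ
    reversible  : ∀ A A' → SameLink A A' →
                  (∀ j → trace A j ≡ trace A' j) ⊎ (∀ j → trace A j ≡ trace A' (opposite j))
    prefix      : ∀ A B → IsPrefix A B → ∀ j → trace A j ≡ trace⁺ B (inject₁ j)
    suffix      : ∀ A B → IsSuffix A B → ∀ j → trace A j ≡ trace⁺ B (suc j)
    alternating : ∀ B j → trace⁺ B (inject₁ j) ≢ trace⁺ B (suc j)

-- A trace of length 2m + 1 in χ colours yields a 3-colouring of 𝕃_ℓ(G) as soon
-- as m rounds of block reduction exhaust the excess χ - 3: colour each link by
-- the reduction of its trace.
traceColouring : ∀ {G ℓ m χ} → Trace G ℓ (double m) χ → iterate shrink (χ ∸ 3) m ≡ 0 →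
                 LinkColouring G ℓ 3
traceColouring {G} {ℓ} {m} {χ} τ exhausted = record
  { col     = colour
  ; wellDef = λ A A' same → fromℕ<-cong _ _ (sameLink A A' (reversible A A' same)) _ _
  ; proper  = λ B A A' pre suf eq →
      reduce-proper x m (seq⁺ B) (λ i _ → belowPalette _) (seq-alternating B)
        (trans (sym (fromPrefix A B pre)) (trans (fromℕ<-injective _ _ _ _ eq) (fromSuffix A' B suf)))
  }
  where
  open Trace τ
  n = double m
  x = χ ∸ 3

  seq : Arc G ℓ → ℕ → ℕ
  seq A i = toℕ (trace A (clamp n i))

  seq⁺ : Arc G (suc ℓ) → ℕ → ℕ
  seq⁺ B i = toℕ (trace⁺ B (clamp (suc n) i))

  belowPalette : (c : Fin χ) → toℕ c < 3 + x
  belowPalette c = <-≤-trans (toℕ<n c) (m≤n+m∸n χ 3)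

  colour : Arc G ℓ → Fin 3
  colour A = fromℕ< (subst (λ e → reduce x m (seq A) < 3 + e) exhausted
                           (reduce-bounded x m (seq A) (λ i _ → belowPalette _)))

  sameLink : ∀ A A' → (∀ j → trace A j ≡ trace A' j) ⊎ (∀ j → trace A j ≡ trace A' (opposite j)) →
             reduce x m (seq A) ≡ reduce x m (seq A')
  sameLink A A' (inj₁ same) = reduce-cong x m _ _ λ i _ → cong toℕ (same _)
  sameLink A A' (inj₂ reversed) = trans
    (reduce-cong x m _ (λ i → seq A' (n ∸ i))
      λ i i≤n → cong toℕ (trans (reversed _) (cong (trace A') (clamp-opposite i≤n))))
    (reduce-reverse x m (seq A'))

  fromPrefix : ∀ A B → IsPrefix A B → reduce x m (seq A) ≡ reduce x m (seq⁺ B)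
  fromPrefix A B pre = reduce-cong x m _ _ λ i i≤n →
    cong toℕ (trans (prefix A B pre _) (cong (trace⁺ B) (sym (clamp-inject₁ i≤n))))

  fromSuffix : ∀ A B → IsSuffix A B → reduce x m (seq A) ≡ reduce x m (seq⁺ B ∘ suc)
  fromSuffix A B suf = reduce-cong x m _ _ λ i _ → cong toℕ (suffix A B suf _)

  seq-alternating : ∀ B → Alternating (suc n) (seq⁺ B)
  seq-alternating B i (s≤s i≤n) eq =
    alternating B (clamp n i) (toℕ-injective (subst (λ j → toℕ (trace⁺ B j) ≡ seq⁺ B (suc i)) (clamp-inject₁ i≤n) eq))

-- Vertex colours along an arc: consecutive vertices are joined by an edge.
vertexTrace : ∀ {G χ} n → Colourable G χ → Trace G n n χ
vertexTrace {G} n (c , properVertex) = record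
  { trace       = λ A → c ∘ vx A
  ; trace⁺      = λ B → c ∘ vx B
  ; reversible  = λ A A' → ⊎-map (λ same j → cong c (proj₁ same j)) (λ rev j → cong c (proj₁ rev j))
  ; prefix      = λ A B pre j → cong c (proj₁ pre j)
  ; suffix      = λ A B suf j → cong c (proj₁ suf j)
  ; alternating = λ B j → ends-differ (joins B j)
  }
  where
  ends-differ : ∀ {e u v} → Joins G e u v → c u ≢ c v
  ends-differ {e} (inj₁ uv) = subst (λ p → c (proj₁ p) ≢ c (proj₂ p)) uv (properVertex e)
  ends-differ {e} (inj₂ vu) = ≢-sym (subst (λ p → c (proj₁ p) ≢ c (proj₂ p)) vu (properVertex e))

joins-endˡ : ∀ {G e u v} → Joins G e u v → IsEnd G u e
joins-endˡ (inj₁ uv) = inj₁ (cong proj₁ uv)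
joins-endˡ (inj₂ vu) = inj₂ (cong proj₂ vu)

joins-endʳ : ∀ {G e u v} → Joins G e u v → IsEnd G v e
joins-endʳ (inj₁ uv) = inj₂ (cong proj₂ uv)
joins-endʳ (inj₂ vu) = inj₁ (cong proj₁ vu)

-- Edge colours along an arc: consecutive edges are distinct (no backtracking)
-- and share a vertex.
edgeTrace : ∀ {G χ} n → EdgeColourable G χ → Trace G (suc n) n χ
edgeTrace {G} n (c , properEdge) = record
  { trace       = λ A → c ∘ ed A
  ; trace⁺      = λ B → c ∘ ed B
  ; reversible  = λ A A' → ⊎-map (λ same j → cong c (proj₂ same j)) (λ rev j → cong c (proj₂ rev j))
  ; prefix      = λ A B pre j → cong c (proj₂ pre j)
  ; suffix      = λ A B suf j → cong c (proj₂ suf j)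
  ; alternating = λ B j →
      properEdge (ed B (inject₁ j)) (ed B (suc j))
        (nonback B (inject₁ j) (suc j) (cong suc (sym (toℕ-inject₁ j))))
        (vx B (suc (inject₁ j)) , joins-endʳ {G} {ed B (inject₁ j)} (joins B (inject₁ j)) ,
                                 joins-endˡ {G} {ed B (suc j)} (joins B (suc j)))
  }

evenLinks : ∀ G ℓ m → ℓ ≡ 2 * m → ∀ χ → IsChromaticNumber G χ →
            (χ ≤ 3 ⊎ 2 ^ ℓ * (χ ∸ 3) ^ 2 < 3 ^ ℓ) → LinkColourable G ℓ 3
evenLinks G .(2 * m) m refl χ (colourable , _) condition =
  subst (λ k → LinkColourable G k 3) (double≡2* m)
        (traceColouring (vertexTrace (double m) colourable) (excess-vanishes m χ condition))

oddLinks : ∀ G ℓ m → ℓ ≡ suc (2 * m) → ∀ χ' → IsChromaticIndex G χ' →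
           (χ' ≤ 3 ⊎ 2 ^ (ℓ ∸ 1) * (χ' ∸ 3) ^ 2 < 3 ^ (ℓ ∸ 1)) → LinkColourable G ℓ 3
oddLinks G .(suc (2 * m)) m refl χ' (edgeColourable , _) condition =
  subst (λ k → LinkColourable G (suc k) 3) (double≡2* m)
        (traceColouring (edgeTrace (double m) edgeColourable) (excess-vanishes m χ' condition))

mainTheorem8 : (G : Graph) (ℓ : ℕ) →
    ((∀ m → ℓ ≡ 2 * m → ∀ χ → IsChromaticNumber G χ →
        (χ ≤ 3 ⊎ 2 ^ ℓ * (χ ∸ 3) ^ 2 < 3 ^ ℓ) → LinkColourable G ℓ 3)
    × (∀ m → ℓ ≡ suc (2 * m) → ∀ χ' → IsChromaticIndex G χ' →
        (χ' ≤ 3 ⊎ 2 ^ (ℓ ∸ 1) * (χ' ∸ 3) ^ 2 < 3 ^ (ℓ ∸ 1)) → LinkColourable G ℓ 3))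
mainTheorem8 G ℓ = evenLinks G ℓ , oddLinks G ℓ
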